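{- (a) If $c$ is an almost node-coloring on a set $A\subseteq\omega^\omega$, then $c\le c_{\operatorname{random}}$ via an embedding $e:A\to\omega^\omega$ which is level preserving, i.e. $\Delta(e(x),e(y))=\Delta(x,y)$ for all distinct $x,y\in A$ (so $e$ is an isometry). (b) If $c$ is an almost node-coloring on a compact set $A\subseteq\omega^\omega$, then $c\le c_{\max}$.
   Context: For $x\ne y$ in $\omega^{\le\omega}$, $\Delta(x,y)=\min\{n:x(n)\ne y(n)\}$; $\omega^\omega$ carries the metric $\operatorname{dist}(x,y)=2^{ -\Delta(x,y)}$. For $A\subseteq\omega^\omega$, $T(A)$ is the tree of finite initial segments of members of $A$, and $\operatorname{succ}_{T(A)}(t)$ the set of immediate successors of $t$ in $T(A)$. A coloring $c:[A]^2\to2$ is an almost node-coloring if there are colorings $c_t:[\operatorname{succ}_{T(A)}(t)]^2\to2$ ($t\in T(A)$) such that for all distinct $x,y\in A$, with $n=\Delta(x,y)$ and $t=x\restriction n$, $c(x,y)=c_t(x\restriction(n+1),y\restriction(n+1))$. Fix the random (Rado) graph on $\omega$ with characteristic function $\chi:[\omega]^2\to2$; $c_{\operatorname{random}}(x,y)=\chi(\{x(n),y(n)\})$ for $x\ne y\in\omega^\omega$, $n=\Delta(x,y)$, and $c_{\max}=c_{\operatorname{random}}\restriction\prod_{n\in\omega}(n+1)$. For colorings $c$ on $X$, $d$ on $Y$, $c\le d$ means there is a topological embedding $e:X\to Y$ with $c(x_0,x_1)=d(e(x_0),e(x_1))$ for all pairs. -}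

module Defs where

open import Data.Nat using (ℕ; _<_; _≤_)
open import Data.Bool using (Bool; true; false)
open import Data.List using (List; map; upTo)
open import Data.List.Membership.Propositional using (_∈_; _∉_)
open import Data.List.Relation.Unary.All using (All)
open import Data.List.Relation.Unary.Any using (Any)
open import Data.Product using (Σ; ∃; _×_)
open import Relation.Binary.PropositionalEquality using (_≡_; _≢_)

Baire : Set
Baire = ℕ → ℕ

Subset : Set₁
Subset = Baire → Set

Agree : Baire → Baire → ℕ → Set
Agree x y k = ∀ i → i < k → x i ≡ y i

DeltaIs : Baire → Baire → ℕ → Set
DeltaIs x y n = Agree x y n × (x n ≢ y n)

restrict : Baire → ℕ → List ℕ
restrict x n = map x (upTo n)

-- A 2-coloring of pairs of points, given as a function on ordered pairs;
-- only its values on distinct pairs from the domain matter.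
Coloring : Set
Coloring = Baire → Baire → Bool

-- c is an almost node-coloring on A: there are colorings c_t of the immediate
-- successors t⌢a of each node t (indexed by the last entry a, a coloring of
-- unordered pairs, hence symmetric) such that
-- c(x,y) = c_t(x↾(n+1), y↾(n+1)) whenever n = Δ(x,y), t = x↾n.
AlmostNodeColoring : Subset → Coloring → Set
AlmostNodeColoring A c =
  Σ (List ℕ → ℕ → ℕ → Bool) λ C →
    (∀ t a b → C t a b ≡ C t b a) ×
    (∀ x y → A x → A y → ∀ n → DeltaIs x y n →
       c x y ≡ C (restrict x n) (x n) (y n))

DisjointL : List ℕ → List ℕ → Set
DisjointL U V = ∀ {z} → z ∈ U → z ∉ V

IsRado : (ℕ → ℕ → Bool) → Set
IsRado χ =
  (∀ a b → χ a b ≡ χ b a) ×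
  (∀ (U V : List ℕ) → DisjointL U V →
     ∃ λ z → (z ∉ U) × (z ∉ V) ×
       All (λ u → χ z u ≡ true) U × All (λ v → χ z v ≡ false) V)

IsEmbedding : Subset → (Baire → Baire) → Set
IsEmbedding A e =
  (∀ x y → A x → A y → (∀ n → e x n ≡ e y n) → ∀ n → x n ≡ y n) ×
  (∀ x → A x → ∀ m → ∃ λ k → ∀ y → A y → Agree x y k → Agree (e x) (e y) m) ×
  (∀ x → A x → ∀ m → ∃ λ k → ∀ y → A y → Agree (e x) (e y) k → Agree x y m)

-- c(x,y) = c_random(e x, e y) for all pairs from A  (c_random w.r.t. χ):
-- whenever n = Δ(e x, e y), c(x,y) = χ(e x n, e y n).
PreservesRandom : (ℕ → ℕ → Bool) → Subset → Coloring → (Baire → Baire) → Set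
PreservesRandom χ A c e =
  ∀ x y → A x → A y → ∀ n → DeltaIs (e x) (e y) n → c x y ≡ χ (e x n) (e y n)

LevelPreserving : Subset → (Baire → Baire) → Set
LevelPreserving A e =
  ∀ x y → A x → A y → ∀ n → DeltaIs x y n → DeltaIs (e x) (e y) n

InMaxSpace : Baire → Set
InMaxSpace y = ∀ n → y n ≤ n

IsOpen : Subset → Set
IsOpen O = ∀ x → O x → ∃ λ k → ∀ y → Agree x y k → O y

Compact : Subset → Set₁
Compact A =
  ∀ (I : Set) (O : I → Subset) → (∀ i → IsOpen (O i)) →
    (∀ x → A x → ∃ λ i → O i x) →
    ∃ λ (F : List I) → ∀ x → A x → Any (λ i → O i x) F

-- Every countable graph embeds into the Rado graph, greedily vertex by vertex using the
-- extension property; so the colouring C t of the successors of each node t is realised by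
-- an injective labelling g t of ω by Rado vertices. Relabelling x as n ↦ g (x↾n) (x n)
-- keeps Δ and turns c into c_random. If A is compact, x n takes only finitely many values
-- for each n, so the possible labels at x↾n are bounded by some H n (x↾n); spreading level n
-- over a block of H n (x↾n) zeros followed by the label puts every entry below its position.
module Submission where

open import Defs
open import Data.Bool using (Bool; true; false)
import Data.Bool.Properties as Bool
open import Data.Empty using (⊥-elim)
open import Data.List using (List; []; _∷_; map; filter)
open import Data.List.Extrema.Nat using (max; xs≤max)
open import Data.List.Membership.Propositional using (_∈_; _∉_)
open import Data.List.Membership.Propositional.Properties
  using (∈-map⁺; ∈-upTo⁻; ∈-map∘filter⁺; ∈-map∘filter⁻)
open import Data.List.Properties using (map-cong-local)
open import Data.List.Relation.Unary.All as All using (All; all?)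
open import Data.List.Relation.Unary.Any using (here; there)
open import Data.Nat using (ℕ; zero; suc; _+_; _≤_; _<_; z≤n; s≤s; _⊔_)
open import Data.Nat.Properties
open import Data.List.Membership.DecPropositional _≟_ using (_∈?_)
open import Data.Product using (Σ; ∃; _×_; _,_; proj₁; proj₂; map₁)
open import Data.Sum using (_⊎_; inj₁; inj₂)
open import Function using (_∘_; case_of_)
open import Function.Definitions using (Injective)
open import Relation.Binary.Definitions using (tri<; tri≈; tri>)
open import Relation.Binary.PropositionalEquality
open import Relation.Nullary using (yes; no)
open import Relation.Nullary.Decidable using (¬?)

module RadoUniversality (χ : ℕ → ℕ → Bool) (rado : IsRado χ) where

  ExtensionWitness : List ℕ → List ℕ → ℕ → Set
  ExtensionWitness U V z =
    (z ∉ U) × (z ∉ V) × All (λ u → χ z u ≡ true) U × All (λ v → χ z v ≡ false) V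

  -- Total, with junk value 0 when U and V meet, so that the embedding below can be
  -- defined before the disjointness of its neighbourhoods is proved.
  witness : List ℕ → List ℕ → ℕ
  witness U V with all? (λ u → ¬? (u ∈? V)) U
  ... | yes U∩V=∅ = proj₁ (proj₂ rado U V (All.lookup U∩V=∅))
  ... | no _ = 0

  witness-spec : ∀ U V → DisjointL U V → ExtensionWitness U V (witness U V)
  witness-spec U V U∩V=∅ with all? (λ u → ¬? (u ∈? V)) U
  ... | yes U∩V=∅′ = proj₂ (proj₂ rado U V (All.lookup U∩V=∅′))
  ... | no ¬U∩V=∅ = ⊥-elim (¬U∩V=∅ (All.tabulate U∩V=∅))

  module Embedding (D : ℕ → ℕ → Bool) where

    side : ℕ → Bool → List (ℕ × ℕ) → List ℕ
    side k b = map proj₂ ∘ filter (λ iv → D k (proj₁ iv) Bool.≟ b)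

    next : ℕ → List (ℕ × ℕ) → ℕ
    next k L = witness (side k true L) (side k false L)

    table : ℕ → List (ℕ × ℕ)
    table zero = []
    table (suc k) = (k , next k (table k)) ∷ table k

    G : ℕ → ℕ
    G k = next k (table k)

    neighbours : ℕ → Bool → List ℕ
    neighbours k b = side k b (table k)

    table-∈⁺ : ∀ {i k} → i < k → (i , G i) ∈ table k
    table-∈⁺ {i} {suc k} (s≤s i≤k) with i ≟ k
    ... | yes refl = here refl
    ... | no i≢k = there (table-∈⁺ (≤∧≢⇒< i≤k i≢k))

    table-∈⁻ : ∀ {i v k} → (i , v) ∈ table k → i < k × v ≡ G i
    table-∈⁻ {k = suc k} (here refl) = n<1+n k , refl
    table-∈⁻ {k = suc k} (there m) = map₁ m<n⇒m<1+n (table-∈⁻ m)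

    G-∈-neighbours : ∀ {i k} → i < k → G i ∈ neighbours k (D k i)
    G-∈-neighbours i<k = ∈-map∘filter⁺ proj₂ _ (_ , table-∈⁺ i<k , refl , refl)

    ∈-neighbours⁻ : ∀ {k b v} → v ∈ neighbours k b → ∃ λ i → i < k × v ≡ G i × D k i ≡ b
    ∈-neighbours⁻ m with ∈-map∘filter⁻ proj₂ _ m
    ... | (i , w) , iw∈ , refl , Dki≡b with table-∈⁻ iw∈
    ...   | i<k , refl = i , i<k , refl , Dki≡b

    InjectiveBelow : ℕ → Set
    InjectiveBelow k = ∀ {i j} → i < k → j < k → G i ≡ G j → i ≡ j

    neighbours-disjoint : ∀ {k} → InjectiveBelow k →
                          DisjointL (neighbours k true) (neighbours k false)
    neighbours-disjoint inj z∈U z∈V with ∈-neighbours⁻ z∈U | ∈-neighbours⁻ z∈V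
    ... | i , i<k , refl , Dki | j , j<k , Gi≡Gj , Dkj
      with refl ← inj i<k j<k Gi≡Gj = case trans (sym Dki) Dkj of λ ()

    G-spec : ∀ {k} → InjectiveBelow k →
             ExtensionWitness (neighbours k true) (neighbours k false) (G k)
    G-spec inj = witness-spec _ _ (neighbours-disjoint inj)

    G-fresh : ∀ {j k} → InjectiveBelow k → j < k → G k ≢ G j
    G-fresh {j} {k} inj j<k Gk≡Gj with D k j | G-∈-neighbours j<k
    ... | true  | Gj∈U = proj₁ (G-spec inj) (subst (_∈ _) (sym Gk≡Gj) Gj∈U)
    ... | false | Gj∈V = proj₁ (proj₂ (G-spec inj)) (subst (_∈ _) (sym Gk≡Gj) Gj∈V)

    G-injectiveBelow : ∀ k → InjectiveBelow k
    G-injectiveBelow (suc k) {i} {j} (s≤s i≤k) (s≤s j≤k) Gi≡Gj with i ≟ k | j ≟ k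
    ... | yes refl | yes refl = refl
    ... | yes refl | no j≢k = ⊥-elim (G-fresh (G-injectiveBelow k) (≤∧≢⇒< j≤k j≢k) Gi≡Gj)
    ... | no i≢k | yes refl = ⊥-elim (G-fresh (G-injectiveBelow k) (≤∧≢⇒< i≤k i≢k) (sym Gi≡Gj))
    ... | no i≢k | no j≢k = G-injectiveBelow k (≤∧≢⇒< i≤k i≢k) (≤∧≢⇒< j≤k j≢k) Gi≡Gj

    G-injective : Injective _≡_ _≡_ G
    G-injective {i} {j} = G-injectiveBelow (suc (i ⊔ j)) (s≤s (m≤m⊔n i j)) (s≤s (m≤n⊔m i j))

    χ-G-below : ∀ {j k} → j < k → χ (G k) (G j) ≡ D k j
    χ-G-below {j} {k} j<k with D k j | G-∈-neighbours j<k
    ... | true  | Gj∈U = All.lookup (proj₁ (proj₂ (proj₂ (G-spec (G-injectiveBelow k))))) Gj∈U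
    ... | false | Gj∈V = All.lookup (proj₂ (proj₂ (proj₂ (G-spec (G-injectiveBelow k))))) Gj∈V

rado-universal : ∀ χ → IsRado χ → (D : ℕ → ℕ → Bool) → (∀ a b → D a b ≡ D b a) →
                 ∃ λ (G : ℕ → ℕ) →
                   Injective _≡_ _≡_ G × (∀ a b → a ≢ b → χ (G a) (G b) ≡ D a b)
rado-universal χ rado D D-sym = G , G-injective , χ-G
  where
  open RadoUniversality.Embedding χ rado D
  χ-G : ∀ a b → a ≢ b → χ (G a) (G b) ≡ D a b
  χ-G a b a≢b with <-cmp a b
  ... | tri< a<b _ _ = trans (proj₁ rado _ _) (trans (χ-G-below a<b) (D-sym b a))
  ... | tri≈ _ a≡b _ = ⊥-elim (a≢b a≡b)
  ... | tri> _ _ b<a = χ-G-below b<a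

Agree-≤ : ∀ {x y m n} → m ≤ n → Agree x y n → Agree x y m
Agree-≤ m≤n x≈y i i<m = x≈y i (≤-trans i<m m≤n)

Agree-suc : ∀ {x y n} → Agree x y n → x n ≡ y n → Agree x y (suc n)
Agree-suc x≈y xn≡yn i (s≤s i≤n) with m≤n⇒m<n∨m≡n i≤n
... | inj₁ i<n = x≈y i i<n
... | inj₂ refl = xn≡yn

restrict-cong : ∀ {x y n} → Agree x y n → restrict x n ≡ restrict y n
restrict-cong x≈y = map-cong-local (All.tabulate (λ i∈ → x≈y _ (∈-upTo⁻ i∈)))

DeltaIs-unique : ∀ {x y m n} → DeltaIs x y m → DeltaIs x y n → m ≡ n
DeltaIs-unique {m = m} {n} (x≈y<m , xm≢ym) (x≈y<n , xn≢yn) with <-cmp m n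
... | tri< m<n _ _ = ⊥-elim (xm≢ym (x≈y<n m m<n))
... | tri≈ _ m≡n _ = m≡n
... | tri> _ _ n<m = ⊥-elim (xn≢yn (x≈y<m n n<m))

Agree⊎DeltaIs : ∀ x y m → Agree x y (suc m) ⊎ Σ ℕ (DeltaIs x y)
Agree⊎DeltaIs x y zero with x 0 ≟ y 0
... | yes x0≡y0 = inj₁ (Agree-suc (λ _ ()) x0≡y0)
... | no x0≢y0 = inj₂ (0 , (λ _ ()) , x0≢y0)
Agree⊎DeltaIs x y (suc m) with Agree⊎DeltaIs x y m
... | inj₂ Δ = inj₂ Δ
... | inj₁ x≈y with x (suc m) ≟ y (suc m)
...   | yes eq = inj₁ (Agree-suc x≈y eq)
...   | no neq = inj₂ (suc m , x≈y , neq)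

-- Block n of spread x is the interval [start x n, start x (suc n)): it holds
-- H n (x↾n) zeros followed, at position slot x n, by the label g (x↾n) (x n).
module Spread (g : List ℕ → ℕ → ℕ) (g-injective : ∀ t → Injective _≡_ _≡_ (g t))
              (H : ℕ → List ℕ → ℕ) where

  start slot : Baire → ℕ → ℕ
  start x zero = 0
  start x (suc n) = suc (slot x n)
  slot x n = start x n + H n (restrict x n)

  block : Baire → ℕ → ℕ
  block x zero = 0
  block x (suc m) with suc m ≟ start x (suc (block x m))
  ... | yes _ = suc (block x m)
  ... | no _ = block x m

  entry : Baire → ℕ → ℕ → ℕ
  entry x m n with m ≟ slot x n
  ... | yes _ = g (restrict x n) (x n)
  ... | no _ = 0

  spread : Baire → Baire
  spread x m = entry x m (block x m)

  start≤slot : ∀ x n → start x n ≤ slot x n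
  start≤slot x n = m≤m+n _ _

  start-mono-≤ : ∀ x {m n} → m ≤ n → start x m ≤ start x n
  start-mono-≤ x {n = zero} z≤n = ≤-refl
  start-mono-≤ x {m} {suc n} m≤1+n with m≤n⇒m<n∨m≡n m≤1+n
  ... | inj₁ (s≤s m≤n) = ≤-trans (start-mono-≤ x m≤n) (m≤n⇒m≤1+n (start≤slot x n))
  ... | inj₂ refl = ≤-refl

  n≤start : ∀ x n → n ≤ start x n
  n≤start x zero = z≤n
  n≤start x (suc n) = s≤s (≤-trans (n≤start x n) (start≤slot x n))

  n≤slot : ∀ x n → n ≤ slot x n
  n≤slot x n = ≤-trans (n≤start x n) (start≤slot x n)

  block-spec : ∀ x m → start x (block x m) ≤ m × m < start x (suc (block x m))
  block-spec x zero = z≤n , s≤s z≤n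
  block-spec x (suc m) with suc m ≟ start x (suc (block x m))
  ... | yes m+1≡s = ≤-reflexive (sym m+1≡s)
                  , s≤s (≤-trans (≤-reflexive m+1≡s) (start≤slot x (suc (block x m))))
  ... | no m+1≢s = m≤n⇒m≤1+n (proj₁ (block-spec x m)) , ≤∧≢⇒< (proj₂ (block-spec x m)) m+1≢s

  block-unique : ∀ x {m n} → start x n ≤ m → m < start x (suc n) → block x m ≡ n
  block-unique x {m} {n} s≤m m<s with <-cmp (block x m) n | block-spec x m
  ... | tri< b<n _ _ | _ , m<s′ = ⊥-elim (<⇒≱ m<s′ (≤-trans (start-mono-≤ x b<n) s≤m))
  ... | tri≈ _ b≡n _ | _ = b≡n
  ... | tri> _ _ n<b | s′≤m , _ = ⊥-elim (<⇒≱ m<s (≤-trans (start-mono-≤ x n<b) s′≤m))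

  spread-slot : ∀ x n → spread x (slot x n) ≡ g (restrict x n) (x n)
  spread-slot x n rewrite block-unique x (start≤slot x n) (n<1+n (slot x n))
    with slot x n ≟ slot x n
  ... | yes _ = refl
  ... | no s≢s = ⊥-elim (s≢s refl)

  start-cong : ∀ {x y} n → Agree x y n → start x n ≡ start y n
  slot-cong : ∀ {x y} n → Agree x y n → slot x n ≡ slot y n
  start-cong zero x≈y = refl
  start-cong (suc n) x≈y = cong suc (slot-cong n (Agree-≤ (n≤1+n n) x≈y))
  slot-cong n x≈y = cong₂ _+_ (start-cong n x≈y) (cong (H n) (restrict-cong x≈y))

  entry-cong : ∀ {x y} m n → Agree x y n → (m ≡ slot x n → x n ≡ y n) →
               entry x m n ≡ entry y m n
  entry-cong {x} {y} m n x≈y xn≡yn with m ≟ slot x n | m ≟ slot y n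
  ... | yes m≡s | yes _ = cong₂ g (restrict-cong x≈y) (xn≡yn m≡s)
  ... | yes m≡s | no m≢s = ⊥-elim (m≢s (trans m≡s (slot-cong n x≈y)))
  ... | no m≢s | yes m≡s = ⊥-elim (m≢s (trans m≡s (sym (slot-cong n x≈y))))
  ... | no _ | no _ = refl

  spread-cong : ∀ {x y} n → Agree x y n → Agree (spread x) (spread y) (slot x n)
  spread-cong {x} {y} n x≈y i i<slot = begin
    entry x i (block x i) ≡⟨ entry-cong i b (Agree-≤ b≤n x≈y) xb≡yb ⟩
    entry y i b           ≡⟨ cong (entry y i) (sym block-y) ⟩
    entry y i (block y i) ∎
    where
    open ≡-Reasoning
    b : ℕ
    b = block x i
    b≤n : b ≤ n
    b≤n = ≮⇒≥ λ n<b → <⇒≱ i<slot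
      (≤-trans (n≤1+n _) (≤-trans (start-mono-≤ x n<b) (proj₁ (block-spec x i))))
    block-y : block y i ≡ b
    block-y = block-unique y
      (subst (_≤ i) (start-cong b (Agree-≤ b≤n x≈y)) (proj₁ (block-spec x i)))
      (subst (i <_) (cong suc (slot-cong b (Agree-≤ b≤n x≈y))) (proj₂ (block-spec x i)))
    xb≡yb : i ≡ slot x b → x b ≡ y b
    xb≡yb i≡slot with m≤n⇒m<n∨m≡n b≤n
    ... | inj₁ b<n = x≈y b b<n
    ... | inj₂ refl = ⊥-elim (<-irrefl i≡slot i<slot)

  spread-continuous : ∀ {x y} m → Agree x y m → Agree (spread x) (spread y) m
  spread-continuous {x} m x≈y = Agree-≤ (n≤slot x m) (spread-cong m x≈y)

  slot-reflects : ∀ {x y} n → Agree x y n → spread x (slot x n) ≡ spread y (slot x n) →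
                  x n ≡ y n
  slot-reflects {x} {y} n x≈y eq = g-injective (restrict x n) (begin
    g (restrict x n) (x n) ≡⟨ sym (spread-slot x n) ⟩
    spread x (slot x n)    ≡⟨ eq ⟩
    spread y (slot x n)    ≡⟨ cong (spread y) (slot-cong n x≈y) ⟩
    spread y (slot y n)    ≡⟨ spread-slot y n ⟩
    g (restrict y n) (y n) ≡⟨ cong (λ t → g t (y n)) (restrict-cong x≈y) ⟨
    g (restrict x n) (y n) ∎)
    where open ≡-Reasoning

  spread-DeltaIs : ∀ {x y} n → DeltaIs x y n → DeltaIs (spread x) (spread y) (slot x n)
  spread-DeltaIs n (x≈y , xn≢yn) = spread-cong n x≈y , xn≢yn ∘ slot-reflects n x≈y

  spread-reflects-Agree : ∀ {x y} m → Agree (spread x) (spread y) (start x m) → Agree x y m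
  spread-reflects-Agree zero _ = λ _ ()
  spread-reflects-Agree {x} {y} (suc m) ex≈ey = Agree-suc x≈y
    (slot-reflects m x≈y (ex≈ey (slot x m) (n<1+n (slot x m))))
    where
    x≈y : Agree x y m
    x≈y = spread-reflects-Agree m (Agree-≤ (m≤n⇒m≤1+n (start≤slot x m)) ex≈ey)

  spread-injective : ∀ x y → (∀ m → spread x m ≡ spread y m) → ∀ n → x n ≡ y n
  spread-injective x y ex≡ey n =
    spread-reflects-Agree (suc n) (λ i _ → ex≡ey i) n (n<1+n n)

  spread-isEmbedding : ∀ A → IsEmbedding A spread
  spread-isEmbedding A = (λ x y _ _ → spread-injective x y)
                       , (λ x _ m → m , λ y _ → spread-continuous m)
                       , (λ x _ m → start x m , λ y _ → spread-reflects-Agree m)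

  spread-DeltaIs⁻ : ∀ {x y m} → DeltaIs (spread x) (spread y) m →
                    ∃ λ n → DeltaIs x y n × m ≡ slot x n
  spread-DeltaIs⁻ {x} {y} {m} Δm with Agree⊎DeltaIs x y m
  ... | inj₁ x≈y = ⊥-elim (proj₂ Δm (spread-continuous (suc m) x≈y m (n<1+n m)))
  ... | inj₂ (n , Δn) = n , Δn , DeltaIs-unique Δm (spread-DeltaIs n Δn)

  spread-preservesRandom :
    ∀ χ (C : List ℕ → ℕ → ℕ → Bool) → (∀ t a b → a ≢ b → χ (g t a) (g t b) ≡ C t a b) →
    ∀ A c → (∀ x y → A x → A y → ∀ n → DeltaIs x y n → c x y ≡ C (restrict x n) (x n) (y n)) →
    PreservesRandom χ A c spread
  spread-preservesRandom χ C χ-g A c c-node x y Ax Ay m Δm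
    with spread-DeltaIs⁻ Δm
  ... | n , Δn@(x≈y , xn≢yn) , refl = begin
    c x y                                          ≡⟨ c-node x y Ax Ay n Δn ⟩
    C (restrict x n) (x n) (y n)                   ≡⟨ χ-g _ _ _ xn≢yn ⟨
    χ (g (restrict x n) (x n)) (g (restrict x n) (y n))
      ≡⟨ cong₂ χ (spread-slot x n) spread-y ⟨
    χ (spread x (slot x n)) (spread y (slot x n))  ∎
    where
    open ≡-Reasoning
    spread-y : spread y (slot x n) ≡ g (restrict x n) (y n)
    spread-y = trans (cong (spread y) (slot-cong n x≈y))
                (trans (spread-slot y n) (cong (λ t → g t (y n)) (sym (restrict-cong x≈y))))

  spread-levelPreserving : (∀ n t → H n t ≡ 0) → ∀ A → LevelPreserving A spread
  spread-levelPreserving H≡0 A x y _ _ n Δn =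
    subst (DeltaIs (spread x) (spread y)) (slot≡ n) (spread-DeltaIs n Δn)
    where
    start≡ : ∀ n → start x n ≡ n
    slot≡ : ∀ n → slot x n ≡ n
    start≡ zero = refl
    start≡ (suc n) = cong suc (slot≡ n)
    slot≡ n = trans (cong₂ _+_ (start≡ n) (H≡0 n _)) (+-identityʳ n)

  spread-InMaxSpace : ∀ x → (∀ n → g (restrict x n) (x n) ≤ H n (restrict x n)) →
                      InMaxSpace (spread x)
  spread-InMaxSpace x g≤H m with m ≟ slot x (block x m)
  ... | yes m≡slot = ≤-trans (g≤H (block x m)) (≤-trans (m≤n+m _ _) (≤-reflexive (sym m≡slot)))
  ... | no _ = z≤n

node-labelling : ∀ χ → IsRado χ → (C : List ℕ → ℕ → ℕ → Bool) → (∀ t a b → C t a b ≡ C t b a) →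
                 ∃ λ (g : List ℕ → ℕ → ℕ) → (∀ t → Injective _≡_ _≡_ (g t)) ×
                   (∀ t a b → a ≢ b → χ (g t a) (g t b) ≡ C t a b)
node-labelling χ rado C C-sym =
  (λ t → proj₁ (universal t)) ,
  (λ t → proj₁ (proj₂ (universal t))) ,
  (λ t → proj₂ (proj₂ (universal t)))
  where
  universal : ∀ t → ∃ λ (G : ℕ → ℕ) →
                Injective _≡_ _≡_ G × (∀ a b → a ≢ b → χ (G a) (G b) ≡ C t a b)
  universal t = rado-universal χ rado (C t) (C-sym t)

almostNodeColoring-levelPreserving : ∀ χ → IsRado χ → ∀ A c → AlmostNodeColoring A c →
  ∃ λ (e : Baire → Baire) → IsEmbedding A e × LevelPreserving A e × PreservesRandom χ A c e
almostNodeColoring-levelPreserving χ rado A c (C , C-sym , c-node)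
  with g , g-injective , χ-g ← node-labelling χ rado C C-sym =
  spread , spread-isEmbedding A , spread-levelPreserving (λ _ _ → refl) A ,
  spread-preservesRandom χ C χ-g A c c-node
  where open Spread g g-injective (λ _ _ → 0)

compact-coordinate-finite : ∀ A → Compact A → ∀ n → ∃ λ (F : List ℕ) → ∀ x → A x → x n ∈ F
compact-coordinate-finite A A-compact n = A-compact ℕ (λ k y → y n ≡ k)
  (λ k x xn≡k → suc n , λ y x≈y → trans (sym (x≈y n (n<1+n n))) xn≡k)
  (λ x _ → x n , refl)

almostNodeColoring-compact : ∀ χ → IsRado χ → ∀ A c → Compact A → AlmostNodeColoring A c →
  ∃ λ (e : Baire → Baire) →
    IsEmbedding A e × (∀ x → A x → InMaxSpace (e x)) × PreservesRandom χ A c e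
almostNodeColoring-compact χ rado A c A-compact (C , C-sym , c-node)
  with g , g-injective , χ-g ← node-labelling χ rado C C-sym =
  spread , spread-isEmbedding A , (λ x Ax → spread-InMaxSpace x (label≤padding x Ax)) ,
  spread-preservesRandom χ C χ-g A c c-node
  where
  values : ℕ → List ℕ
  values n = proj₁ (compact-coordinate-finite A A-compact n)

  padding : ℕ → List ℕ → ℕ
  padding n t = max 0 (map (g t) (values n))

  open Spread g g-injective padding

  label≤padding : ∀ x → A x → ∀ n → g (restrict x n) (x n) ≤ padding n (restrict x n)
  label≤padding x Ax n = All.lookup (xs≤max 0 _)
    (∈-map⁺ (g _) (proj₂ (compact-coordinate-finite A A-compact n) x Ax))

mainTheorem14 : (χ : ℕ → ℕ → Bool) → IsRado χ →
    ((A : Subset) (c : Coloring) → AlmostNodeColoring A c →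
      ∃ λ (e : Baire → Baire) →
        IsEmbedding A e × LevelPreserving A e × PreservesRandom χ A c e)
    ×
    ((A : Subset) (c : Coloring) → Compact A → AlmostNodeColoring A c →
      ∃ λ (e : Baire → Baire) →
        IsEmbedding A e × (∀ x → A x → InMaxSpace (e x)) × PreservesRandom χ A c e)
mainTheorem14 χ rado =
  almostNodeColoring-levelPreserving χ rado , almostNodeColoring-compact χ rado
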